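{- If a graph $G$ has a consistent 2-join $(X_1,X_2)$, then $|X_1|\ge 4$ and $|X_2|\ge 4$.
   Context: An almost 2-join of $G$ is a partition $(X_1,X_2)$ of $V(G)$ such that for $i=1,2$, $X_i$ contains disjoint nonempty sets $A_i,B_i$, every node of $A_1$ is adjacent to every node of $A_2$, every node of $B_1$ is adjacent to every node of $B_2$, there are no other edges between $X_1$ and $X_2$, and $|X_i|\ge3$. It is a 2-join if moreover, for $i=1,2$, $G[X_i]$ contains a path from $A_i$ to $B_i$, and if $|A_i|=|B_i|=1$ then $G[X_i]$ is not a chordless path. It is consistent if for $i=1,2$: (1) every component of $G[X_i]$ meets both $A_i$ and $B_i$; (2) every node of $A_i$ has a non-neighbor in $B_i$; (3) every node of $B_i$ has a non-neighbor in $A_i$; (4) either $A_1,A_2$ are both cliques, or one of them is a single node and the other is a disjoint union of cliques; (5) the same for $B_1,B_2$; (6) $G[X_i]$ is connected; (7) every node $v\in X_i$ has a path to some node of $B_i$ with no internal node in $A_i$; (8) every node $v\in X_i$ has a path to some node of $A_i$ with no internal node in $B_i$. -}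

module Defs where

open import Data.Nat using (ℕ; suc; _+_; _≥_)
open import Data.Fin using (Fin; toℕ)
open import Data.Fin.Subset using (Subset; _∈_; _∉_; _⊆_; ∣_∣; Nonempty)
open import Data.List using (List; []; _∷_; _∷ʳ_)
open import Data.List.Relation.Unary.All using (All)
open import Data.List.Relation.Unary.Unique.Propositional using (Unique)
open import Data.Product using (Σ; _×_; ∃; ∃-syntax)
open import Data.Unit using (⊤)
open import Data.Sum using (_⊎_)
open import Relation.Binary.PropositionalEquality using (_≡_; _≢_)
open import Relation.Nullary using (¬_)
open import Function.Bundles using (_⇔_)
open import Function.Definitions using (Injective)

record Graph : Set₁ where
  field
    n     : ℕ
    Adj   : Fin n → Fin n → Set
    sym   : ∀ {u v} → Adj u v → Adj v u
    irrefl : ∀ {u} → ¬ Adj u u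

module _ (G : Graph) where
  open Graph G

  V : Set
  V = Fin n

  data Chain : V → List V → V → Set where
    edge : ∀ {u v} → Adj u v → Chain u [] v
    step : ∀ {u w ys v} → Adj u w → Chain w ys v → Chain u (w ∷ ys) v

  -- A path in G[S] from u to v whose internal nodes all satisfy P.
  -- Either the trivial one-node path (u ≡ v), or a chain with distinct nodes.
  PathIn : Subset n → (V → Set) → V → V → Set
  PathIn S P u v =
    (u ≡ v × u ∈ S) ⊎
    (Σ (List V) λ ys → Chain u ys v
                     × Unique (u ∷ (ys ∷ʳ v))
                     × All (_∈ S) (u ∷ (ys ∷ʳ v))
                     × All P ys)

  Path : Subset n → V → V → Set
  Path S u v = PathIn S (λ _ → ⊤) u v

  Connected : Subset n → Set
  Connected S = ∀ u v → u ∈ S → v ∈ S → Path S u v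

  Disjoint : Subset n → Subset n → Set
  Disjoint A B = ∀ v → v ∈ A → v ∉ B

  IsClique : Subset n → Set
  IsClique A = ∀ u v → u ∈ A → v ∈ A → u ≢ v → Adj u v

  -- G[A] is a disjoint union of cliques: A is partitioned into classes
  -- (labels c) so that distinct nodes of A are adjacent iff same class.
  IsDisjointUnionOfCliques : Subset n → Set
  IsDisjointUnionOfCliques A =
    Σ (V → ℕ) λ c → ∀ u v → u ∈ A → v ∈ A → u ≢ v → (Adj u v ⇔ (c u ≡ c v))

  -- G[X] is a chordless path: an injective enumeration f of X by Fin k
  -- such that f i , f j adjacent iff i , j consecutive.
  IsChordlessPath : Subset n → Set
  IsChordlessPath X =
    Σ ℕ λ k → Σ (Fin k → V) λ f →
      Injective _≡_ _≡_ f
      × (∀ v → v ∈ X ⇔ (∃[ i ] f i ≡ v))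
      × (∀ i j → Adj (f i) (f j) ⇔ ((suc (toℕ i) ≡ toℕ j) ⊎ (suc (toℕ j) ≡ toℕ i)))

  record Almost2Join (X₁ X₂ A₁ B₁ A₂ B₂ : Subset n) : Set where
    field
      cover     : ∀ v → v ∈ X₁ ⊎ v ∈ X₂
      disjX     : Disjoint X₁ X₂
      A₁⊆X₁     : A₁ ⊆ X₁
      B₁⊆X₁     : B₁ ⊆ X₁
      A₂⊆X₂     : A₂ ⊆ X₂
      B₂⊆X₂     : B₂ ⊆ X₂
      disj₁     : Disjoint A₁ B₁
      disj₂     : Disjoint A₂ B₂
      neA₁      : Nonempty A₁
      neB₁      : Nonempty B₁
      neA₂      : Nonempty A₂
      neB₂      : Nonempty B₂
      between   : ∀ u v → u ∈ X₁ → v ∈ X₂ →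
                    (Adj u v ⇔ ((u ∈ A₁ × v ∈ A₂) ⊎ (u ∈ B₁ × v ∈ B₂)))
      size₁     : ∣ X₁ ∣ ≥ 3
      size₂     : ∣ X₂ ∣ ≥ 3

  -- extra conditions of a 2-join, for side i given X A B
  TwoJoinSide : Subset n → Subset n → Subset n → Set
  TwoJoinSide X A B =
    (∃[ a ] ∃[ b ] (a ∈ A × b ∈ B × Path X a b))
    × (∣ A ∣ ≡ 1 → ∣ B ∣ ≡ 1 → ¬ IsChordlessPath X)

  CliqueCond : Subset n → Subset n → Set
  CliqueCond A₁ A₂ =
    (IsClique A₁ × IsClique A₂)
    ⊎ (∣ A₁ ∣ ≡ 1 × IsDisjointUnionOfCliques A₂)
    ⊎ (∣ A₂ ∣ ≡ 1 × IsDisjointUnionOfCliques A₁)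

  -- consistency conditions (1),(2),(3),(6),(7),(8) for side i
  ConsistentSide : Subset n → Subset n → Subset n → Set
  ConsistentSide X A B =
    -- (1) every component of G[X] meets both A and B
    (∀ v → v ∈ X → (∃[ a ] (a ∈ A × Path X v a)) × (∃[ b ] (b ∈ B × Path X v b)))
    × (∀ a → a ∈ A → ∃[ b ] (b ∈ B × ¬ Adj a b))
    × (∀ b → b ∈ B → ∃[ a ] (a ∈ A × ¬ Adj b a))
    × Connected X
    × (∀ v → v ∈ X → ∃[ b ] (b ∈ B × PathIn X (_∉ A) v b))
    × (∀ v → v ∈ X → ∃[ a ] (a ∈ A × PathIn X (_∉ B) v a))

  record Consistent2Join (X₁ X₂ A₁ B₁ A₂ B₂ : Subset n) : Set where
    field
      almost : Almost2Join X₁ X₂ A₁ B₁ A₂ B₂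
      join₁  : TwoJoinSide X₁ A₁ B₁
      join₂  : TwoJoinSide X₂ A₂ B₂
      cons₁  : ConsistentSide X₁ A₁ B₁
      cons₂  : ConsistentSide X₂ A₂ B₂
      condA  : CliqueCond A₁ A₂
      condB  : CliqueCond B₁ B₂

-- Pick a ∈ A and a non-neighbour b ∈ B (condition (2)). A path from a to b in G[X]
-- must pass through some c, so a, c, b are three distinct nodes of X. If X had no
-- fourth node, the path would be a–c–b. Then c ∉ A, since (2) for c would give a
-- fourth node of B (not a, not c, not the neighbour b); symmetrically c ∉ B by (3).
-- Hence A = {a}, B = {b} and G[X] is the chordless path a–c–b, which a 2-join excludes.
module Submission where

open import Defs
open import Data.Nat using (_≥_)
open import Data.Fin.Subset using (Subset; ∣_∣)
open import Data.Product using (_×_)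

open import Data.Nat using (ℕ; _≤_; z≤n; s≤s)
open import Data.Nat.Properties using (≤-trans)
open import Data.Fin using (Fin; zero; suc; toℕ; _≟_)
open import Data.Fin.Subset using (_∈_; _⊆_; _-_; ⁅_⁆; Nonempty)
open import Data.Fin.Subset.Properties
  using (x∈p∧x≢y⇒x∈p-y; x∈p⇒∣p-x∣<∣p∣; _∈?_; ⊆-antisym; ∣⁅x⁆∣≡1; x∈⁅x⁆; x∈⁅y⁆⇒x≡y)
open import Data.Fin.Properties using (any?)
open import Data.Product using (_,_; proj₂; ∃-syntax)
open import Data.Sum using (_⊎_; inj₁; inj₂; [_,_])
open import Data.Empty using (⊥-elim)
open import Data.List using (List; []; _∷_; _∷ʳ_; length)
open import Data.List.Relation.Unary.All using (All; []; _∷_)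
open import Data.List.Relation.Unary.All.Properties using (∷ʳ⁻)
open import Data.List.Relation.Unary.AllPairs using ([]; _∷_)
open import Data.List.Relation.Unary.Unique.Propositional using (Unique)
open import Relation.Binary.PropositionalEquality using (_≡_; _≢_; refl; sym; subst; ≢-sym)
open import Relation.Nullary using (¬_; yes; no)
open import Relation.Nullary.Decidable using (_×-dec_; ¬?)
open import Function.Base using (id)
open import Function.Bundles using (_⇔_; mk⇔)

private
  variable
    m : ℕ

length≤∣p∣ : {p : Subset m} {xs : List (Fin m)} → Unique xs → All (_∈ p) xs → length xs ≤ ∣ p ∣
length≤∣p∣ [] [] = z≤n
length≤∣p∣ {p = p} {xs = x ∷ _} (x≢xs ∷ uxs) (x∈p ∷ xs⊆p) =
  ≤-trans (s≤s (length≤∣p∣ uxs (remove x≢xs xs⊆p))) (x∈p⇒∣p-x∣<∣p∣ x∈p)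
  where
  remove : ∀ {ys} → All (x ≢_) ys → All (_∈ p) ys → All (_∈ p - x) ys
  remove []           []           = []
  remove (x≢y ∷ x≢ys) (y∈p ∷ ys⊆p) = x∈p∧x≢y⇒x∈p-y y∈p (≢-sym x≢y) ∷ remove x≢ys ys⊆p

∣p∣≡1 : {p : Subset m} {x : Fin m} → x ∈ p → (∀ y → y ∈ p → y ≡ x) → ∣ p ∣ ≡ 1
∣p∣≡1 {p = p} {x} x∈p p⊆x = subst (λ q → ∣ q ∣ ≡ 1) (⊆-antisym x⊆p p⊆⁅x⁆) (∣⁅x⁆∣≡1 x)
  where
  x⊆p : ⁅ x ⁆ ⊆ p
  x⊆p y∈⁅x⁆ = subst (_∈ p) (sym (x∈⁅y⁆⇒x≡y x y∈⁅x⁆)) x∈p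
  p⊆⁅x⁆ : p ⊆ ⁅ x ⁆
  p⊆⁅x⁆ {y} y∈p = subst (_∈ ⁅ x ⁆) (sym (p⊆x y y∈p)) (x∈⁅x⁆ x)

module _ (G : Graph) where
  open Graph G renaming (sym to Adj-sym)

  adj⇒≢ : ∀ {u v} → Adj u v → u ≢ v
  adj⇒≢ uv refl = irrefl uv

  disjoint⇒≢ : ∀ {A B u v} → Disjoint G A B → u ∈ A → v ∈ B → u ≢ v
  disjoint⇒≢ A∩B≡∅ u∈A v∈B refl = A∩B≡∅ _ u∈A v∈B

  FourthNode : Subset n → V G → V G → V G → Set
  FourthNode X a c b = ∃[ d ] (d ∈ X × d ≢ a × d ≢ c × d ≢ b)

  fourthNode⇒∣X∣≥4 : ∀ {X a c b} → a ∈ X → c ∈ X → b ∈ X →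
    a ≢ c → a ≢ b → c ≢ b → FourthNode X a c b → ∣ X ∣ ≥ 4
  fourthNode⇒∣X∣≥4 {a = a} {c} {b} a∈X c∈X b∈X a≢c a≢b c≢b (d , d∈X , d≢a , d≢c , d≢b) =
    length≤∣p∣ distinct (a∈X ∷ c∈X ∷ b∈X ∷ d∈X ∷ [])
    where
    distinct : Unique (a ∷ c ∷ b ∷ d ∷ [])
    distinct = (a≢c ∷ a≢b ∷ ≢-sym d≢a ∷ []) ∷ (c≢b ∷ ≢-sym d≢c ∷ []) ∷ (≢-sym d≢b ∷ []) ∷ [] ∷ []

  fourthNode⊎⊆triple : ∀ X a c b →
    FourthNode X a c b ⊎ (∀ v → v ∈ X → v ≡ a ⊎ v ≡ c ⊎ v ≡ b)
  fourthNode⊎⊆triple X a c b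
    with any? (λ d → (d ∈? X) ×-dec ¬? (d ≟ a) ×-dec ¬? (d ≟ c) ×-dec ¬? (d ≟ b))
  ... | yes fourth = inj₁ fourth
  ... | no ¬fourth = inj₂ ⊆triple
    where
    ⊆triple : ∀ v → v ∈ X → v ≡ a ⊎ v ≡ c ⊎ v ≡ b
    ⊆triple v v∈X with v ≟ a | v ≟ c | v ≟ b
    ... | yes v≡a | _       | _       = inj₁ v≡a
    ... | no _    | yes v≡c | _       = inj₂ (inj₁ v≡c)
    ... | no _    | no _    | yes v≡b = inj₂ (inj₂ v≡b)
    ... | no v≢a  | no v≢c  | no v≢b  = ⊥-elim (¬fourth (v , v∈X , v≢a , v≢c , v≢b))

  path⇒secondNode : ∀ {X P u v} → PathIn G X P u v → u ≢ v → ¬ Adj u v →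
    ∃[ w ] (w ∈ X × Adj u w × w ≢ v × (Adj w v ⊎ FourthNode X u w v))
  path⇒secondNode (inj₁ (u≡v , _)) u≢v _ = ⊥-elim (u≢v u≡v)
  path⇒secondNode (inj₂ ([] , edge uv , _)) _ ¬uv = ⊥-elim (¬uv uv)
  path⇒secondNode (inj₂ (w ∷ [] , step uw (edge wv) , _ ∷ (w≢v ∷ []) ∷ _ , _ ∷ w∈X ∷ _ , _)) _ _ =
    w , w∈X , uw , w≢v , inj₁ wv
  path⇒secondNode {v = v}
    (inj₂ (w ∷ x ∷ ys , step uw (step wx _) ,
           (_ ∷ u≢x ∷ _) ∷ (_ ∷ w≢rest) ∷ x≢rest ∷ _ , _ ∷ w∈X ∷ x∈X ∷ _ , _)) _ _ =
    w , w∈X , uw , last w≢rest , inj₂ (x , x∈X , ≢-sym u≢x , ≢-sym (adj⇒≢ wx) , last x≢rest)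
    where
    last : ∀ {y} → All (y ≢_) (ys ∷ʳ v) → y ≢ v
    last y≢ = proj₂ (∷ʳ⁻ {xs = ys} y≢)

  induced-P₃⇒isChordlessPath : ∀ {X a c b} → a ∈ X → c ∈ X → b ∈ X →
    (∀ v → v ∈ X → v ≡ a ⊎ v ≡ c ⊎ v ≡ b) →
    Adj a c → Adj c b → ¬ Adj a b → a ≢ b → IsChordlessPath G X
  induced-P₃⇒isChordlessPath {X} {a} {c} {b} a∈X c∈X b∈X ⊆triple ac cb ¬ab a≢b =
    3 , f , injective , enumerates , consecutive
    where
    f : Fin 3 → V G
    f zero             = a
    f (suc zero)       = c
    f (suc (suc zero)) = b

    Consecutive : Fin 3 → Fin 3 → Set
    Consecutive i j = (ℕ.suc (toℕ i) ≡ toℕ j) ⊎ (ℕ.suc (toℕ j) ≡ toℕ i)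

    injective : ∀ {i j} → f i ≡ f j → i ≡ j
    injective {zero}             {zero}             _ = refl
    injective {suc zero}         {suc zero}         _ = refl
    injective {suc (suc zero)}   {suc (suc zero)}   _ = refl
    injective {zero}             {suc zero}         e = ⊥-elim (adj⇒≢ ac e)
    injective {zero}             {suc (suc zero)}   e = ⊥-elim (a≢b e)
    injective {suc zero}         {zero}             e = ⊥-elim (adj⇒≢ ac (sym e))
    injective {suc zero}         {suc (suc zero)}   e = ⊥-elim (adj⇒≢ cb e)
    injective {suc (suc zero)}   {zero}             e = ⊥-elim (a≢b (sym e))
    injective {suc (suc zero)}   {suc zero}         e = ⊥-elim (adj⇒≢ cb (sym e))

    enumerates : ∀ v → v ∈ X ⇔ (∃[ i ] f i ≡ v)
    enumerates v = mk⇔ index member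
      where
      index : v ∈ X → ∃[ i ] f i ≡ v
      index v∈X with ⊆triple v v∈X
      ... | inj₁ v≡a        = zero , sym v≡a
      ... | inj₂ (inj₁ v≡c) = suc zero , sym v≡c
      ... | inj₂ (inj₂ v≡b) = suc (suc zero) , sym v≡b
      member : ∃[ i ] f i ≡ v → v ∈ X
      member (zero , refl)           = a∈X
      member (suc zero , refl)       = c∈X
      member (suc (suc zero) , refl) = b∈X

    edge⇔ : ∀ {i j} → Adj (f i) (f j) → Consecutive i j → Adj (f i) (f j) ⇔ Consecutive i j
    edge⇔ e c = mk⇔ (λ _ → c) (λ _ → e)

    nonEdge⇔ : ∀ {i j} → ¬ Adj (f i) (f j) → ¬ Consecutive i j → Adj (f i) (f j) ⇔ Consecutive i j
    nonEdge⇔ ¬e ¬c = mk⇔ (λ e → ⊥-elim (¬e e)) (λ c → ⊥-elim (¬c c))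

    consecutive : ∀ i j → Adj (f i) (f j) ⇔ Consecutive i j
    consecutive zero             zero             = nonEdge⇔ irrefl λ { (inj₁ ()) ; (inj₂ ()) }
    consecutive zero             (suc zero)       = edge⇔ ac (inj₁ refl)
    consecutive zero             (suc (suc zero)) = nonEdge⇔ ¬ab λ { (inj₁ ()) ; (inj₂ ()) }
    consecutive (suc zero)       zero             = edge⇔ (Adj-sym ac) (inj₂ refl)
    consecutive (suc zero)       (suc zero)       = nonEdge⇔ irrefl λ { (inj₁ ()) ; (inj₂ ()) }
    consecutive (suc zero)       (suc (suc zero)) = edge⇔ cb (inj₁ refl)
    consecutive (suc (suc zero)) zero             = nonEdge⇔ (λ ba → ¬ab (Adj-sym ba)) λ { (inj₁ ()) ; (inj₂ ()) }
    consecutive (suc (suc zero)) (suc zero)       = edge⇔ (Adj-sym cb) (inj₂ refl)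
    consecutive (suc (suc zero)) (suc (suc zero)) = nonEdge⇔ irrefl λ { (inj₁ ()) ; (inj₂ ()) }

  induced-P₃⇒fourthNode : ∀ {X A B a c b} → A ⊆ X → B ⊆ X → Disjoint G A B →
    TwoJoinSide G X A B → ConsistentSide G X A B →
    a ∈ A → c ∈ X → b ∈ B → Adj a c → Adj c b → ¬ Adj a b → FourthNode X a c b
  induced-P₃⇒fourthNode {X} {A} {B} {a} {c} {b} A⊆X B⊆X A∩B≡∅ (_ , ¬chordless)
    (_ , nonNbrInB , nonNbrInA , _) a∈A c∈X b∈B ac cb ¬ab
    with c ∈? A | c ∈? B
  ... | yes c∈A | _ =
    let d , d∈B , ¬cd = nonNbrInB c c∈A in
    d , B⊆X d∈B , ≢-sym (disjoint⇒≢ A∩B≡∅ a∈A d∈B) , ≢-sym (disjoint⇒≢ A∩B≡∅ c∈A d∈B)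
      , (λ { refl → ¬cd cb })
  ... | no _ | yes c∈B =
    let d , d∈A , ¬cd = nonNbrInA c c∈B in
    d , A⊆X d∈A , (λ { refl → ¬cd (Adj-sym ac) }) , disjoint⇒≢ A∩B≡∅ d∈A c∈B
      , disjoint⇒≢ A∩B≡∅ d∈A b∈B
  ... | no c∉A | no c∉B
    with fourthNode⊎⊆triple X a c b
  ...   | inj₁ d       = d
  ...   | inj₂ ⊆triple =
    ⊥-elim (¬chordless (∣p∣≡1 a∈A onlyA) (∣p∣≡1 b∈B onlyB)
      (induced-P₃⇒isChordlessPath (A⊆X a∈A) c∈X (B⊆X b∈B) ⊆triple ac cb ¬ab a≢b))
    where
    a≢b : a ≢ b
    a≢b = disjoint⇒≢ A∩B≡∅ a∈A b∈B
    onlyA : ∀ v → v ∈ A → v ≡ a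
    onlyA v v∈A with ⊆triple v (A⊆X v∈A)
    ... | inj₁ v≡a         = v≡a
    ... | inj₂ (inj₁ refl) = ⊥-elim (c∉A v∈A)
    ... | inj₂ (inj₂ v≡b)  = ⊥-elim (disjoint⇒≢ A∩B≡∅ v∈A b∈B v≡b)
    onlyB : ∀ v → v ∈ B → v ≡ b
    onlyB v v∈B with ⊆triple v (B⊆X v∈B)
    ... | inj₁ v≡a         = ⊥-elim (disjoint⇒≢ A∩B≡∅ a∈A v∈B (sym v≡a))
    ... | inj₂ (inj₁ refl) = ⊥-elim (c∉B v∈B)
    ... | inj₂ (inj₂ v≡b)  = v≡b

  consistentSide⇒∣X∣≥4 : ∀ {X A B} → A ⊆ X → B ⊆ X → Disjoint G A B → Nonempty A →
    TwoJoinSide G X A B → ConsistentSide G X A B → ∣ X ∣ ≥ 4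
  consistentSide⇒∣X∣≥4 {X} A⊆X B⊆X A∩B≡∅ (a , a∈A) join cons@(_ , nonNbrInB , _ , connected , _)
    with nonNbrInB a a∈A
  ... | b , b∈B , ¬ab
    with path⇒secondNode (connected a b (A⊆X a∈A) (B⊆X b∈B)) (disjoint⇒≢ A∩B≡∅ a∈A b∈B) ¬ab
  ... | c , c∈X , ac , c≢b , next =
    fourthNode⇒∣X∣≥4 (A⊆X a∈A) c∈X (B⊆X b∈B) (adj⇒≢ ac) (disjoint⇒≢ A∩B≡∅ a∈A b∈B) c≢b fourth
    where
    fourth : FourthNode X a c b
    fourth = [ (λ cb → induced-P₃⇒fourthNode A⊆X B⊆X A∩B≡∅ join cons a∈A c∈X b∈B ac cb ¬ab) , id ] next

lemma6p6 : (G : Graph) → (X₁ X₂ A₁ B₁ A₂ B₂ : Subset (Graph.n G)) →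
    Consistent2Join G X₁ X₂ A₁ B₁ A₂ B₂ → (∣ X₁ ∣ ≥ 4) × (∣ X₂ ∣ ≥ 4)
lemma6p6 G X₁ X₂ A₁ B₁ A₂ B₂ J =
  consistentSide⇒∣X∣≥4 G A₁⊆X₁ B₁⊆X₁ disj₁ neA₁ join₁ cons₁ ,
  consistentSide⇒∣X∣≥4 G A₂⊆X₂ B₂⊆X₂ disj₂ neA₂ join₂ cons₂
  where
  open Consistent2Join J
  open Almost2Join almost
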